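{- Let $\mathcal{N}$ be a monotone Boolean automata network with structure $G=(V,A)$. Every critical cycle of $\mathcal{N}$ is either positive with an even length or negative with an odd length.
   Context: Let $\mathbb{B}=\{0,1\}$, $V=\{0,\ldots,n-1\}$. For $x\in\mathbb{B}^n$ and $j\in V$, $\bar{x}^{j}$ is $x$ with its $j$-th coordinate negated. Let $\mathbf{s}(b)=b-\neg b$ for $b\in\mathbb{B}$ (so $\mathbf{s}(1)=1,\mathbf{s}(0)=-1$). A monotone Boolean automata network of size $n$ is a family $\mathcal{N}=\{f_i:\mathbb{B}^n\to\mathbb{B};\ i\in V\}$ such that for all $i,j\in V$, either $\mathbf{s}(x_j)(f_i(x)-f_i(\bar{x}^{j}))\ge0$ for all $x$, or $\mathbf{s}(x_j)(f_i(x)-f_i(\bar{x}^{j}))\le0$ for all $x$. Its structure is the digraph $G=(V,A)$, $A=\{(j,i);\ \exists x,\ f_i(x)\neq f_i(\bar{x}^{j})\}$, with arc signs $\mathrm{sign}(j,i)=\mathbf{s}(x_j)(f_i(x)-f_i(\bar{x}^{j}))\in\{\pm1\}$ for any $x$ with $f_i(x)\neq f_i(\bar{x}^{j})$. $U(x)=\{i;\ f_i(x)\neq x_i\}$. The set of arcs frustrated in $x$ is $\mathrm{FRUS}(x)=\{(j,i)\in A;\ \mathbf{s}(x_j)\mathbf{s}(x_i)=-\mathrm{sign}(j,i)\}$. A cycle of $\mathcal{N}$ is a subgraph $C=(V_C,A_C)$ of $G$ corresponding to a closed directed walk, with possibly repeated nodes but no repeated arcs; its length is its number of arcs and its sign is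 the product of the signs of its arcs (positive if $+1$, negative if $-1$). A cycle $C$ is $x$-critical if $V_C\subseteq U(x)$ and $A_C\subseteq\mathrm{FRUS}(x)$, and critical if it is $x$-critical for some $x\in\mathbb{B}^n$. -}

module Defs where

open import Relation.Nullary using (yes; no)
open import Data.Bool using (Bool; true; false; not)
open import Data.Nat as ℕ using (ℕ; zero; suc; _%_)
open import Data.Nat.DivMod using (m%n<n)
open import Data.Fin using (Fin; toℕ; fromℕ<; _≟_)
import Data.Fin
open import Data.Integer as ℤ using (ℤ; +_; -_; 0ℤ; 1ℤ; _≥_; _≤_)
open import Data.Product using (Σ; ∃; _×_; _,_)
open import Data.Sum using (_⊎_)
open import Relation.Binary.PropositionalEquality using (_≡_; _≢_)

Config : ℕ → Set
Config n = Fin n → Bool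

flipAt : ∀ {n} → Config n → Fin n → Config n
flipAt x j k with k ≟ j
... | yes _ = not (x k)
... | no  _ = x k

⟦_⟧ : Bool → ℤ
⟦ true ⟧  = 1ℤ
⟦ false ⟧ = 0ℤ

s : Bool → ℤ
s b = ⟦ b ⟧ ℤ.- ⟦ not b ⟧

BAN : ℕ → Set
BAN n = Fin n → Config n → Bool

effect : ∀ {n} → BAN n → Fin n → Fin n → Config n → ℤ
effect f j i x = s (x j) ℤ.* (⟦ f i x ⟧ ℤ.- ⟦ f i (flipAt x j) ⟧)

Monotone : ∀ {n} → BAN n → Set
Monotone {n} f = ∀ (i j : Fin n) →
  (∀ x → effect f j i x ≥ 0ℤ) ⊎ (∀ x → effect f j i x ≤ 0ℤ)

IsArc : ∀ {n} → BAN n → Fin n → Fin n → Set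
IsArc {n} f j i = ∃ λ (x : Config n) → f i x ≢ f i (flipAt x j)

record Arc {n : ℕ} (f : BAN n) : Set where
  constructor arc
  field
    src : Fin n
    tgt : Fin n
    isArc : IsArc f src tgt
open Arc public

-- sign(j,i) = s(x_j)(f_i(x) - f_i(x̄ʲ)) for a witness x with f_i(x) ≠ f_i(x̄ʲ)
-- (independent of the witness when the network is monotone)
sign : ∀ {n} {f : BAN n} → Arc f → ℤ
sign {f = f} (arc j i (x , _)) = effect f j i x

InU : ∀ {n} → BAN n → Config n → Fin n → Set
InU f x i = f i x ≢ x i

Frustrated : ∀ {n} {f : BAN n} → Config n → Arc f → Set
Frustrated x a = s (x (src a)) ℤ.* s (x (tgt a)) ≡ - sign a

next : ∀ {m} → Fin (suc m) → Fin (suc m)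
next {m} t = fromℕ< (m%n<n (suc (toℕ t)) (suc m))

prod : ∀ {k} → (Fin k → ℤ) → ℤ
prod {zero}  g = 1ℤ
prod {suc k} g = g Data.Fin.zero ℤ.* prod {k} (λ t → g (Data.Fin.suc t))

record Cycle {n : ℕ} (f : BAN n) (m : ℕ) : Set where
  field
    arcs      : Fin (suc m) → Arc f
    closed    : ∀ t → tgt (arcs t) ≡ src (arcs (next t))
    noRepeat  : ∀ t t' → src (arcs t) ≡ src (arcs t') →
                tgt (arcs t) ≡ tgt (arcs t') → t ≡ t'
open Cycle public

length : ∀ {n} {f : BAN n} {m} → Cycle f m → ℕ
length {m = m} _ = suc m

cycleSign : ∀ {n} {f : BAN n} {m} → Cycle f m → ℤ
cycleSign C = prod (λ t → sign (arcs C t))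

-- C is x-critical: V_C ⊆ U(x) and A_C ⊆ FRUS(x)
-- (every node of C is the source of one of its arcs)
XCritical : ∀ {n} {f : BAN n} {m} → Config n → Cycle f m → Set
XCritical {f = f} x C =
  (∀ t → InU f x (src (arcs C t))) × (∀ t → Frustrated x (arcs C t))

Critical : ∀ {n} {f : BAN n} {m} → Cycle f m → Set
Critical {n} C = ∃ λ (x : Config n) → XCritical x C

-- In a critical configuration every arc of the cycle is frustrated, so its
-- sign is −s(x_j)s(x_i).  Multiplying along the cycle, every node occurs once
-- as a source and once as a target, so the factors s(x_i) pair up to
-- s(x_i)² = 1 and only the signs (−1)^length survive.
module Submission where

open import Defs
open import Data.Nat using (ℕ)
open import Data.Nat.Divisibility using (_∣_)
open import Data.Integer using (1ℤ; -1ℤ)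
open import Data.Product using (_×_)
open import Data.Sum using (_⊎_)
open import Relation.Binary.PropositionalEquality using (_≡_)
open import Relation.Nullary using (¬_)

open import Data.Bool using (true; false)
open import Data.Nat as ℕ using (zero; suc)
open import Data.Nat.DivMod using (m<n⇒m%n≡m; n%n≡0)
open import Data.Nat.Divisibility using (_∣0; ∣1⇒≡1; ∣-refl; ∣m∣n⇒∣m+n; ∣m+n∣m⇒∣n)
open import Data.Integer using (ℤ; _*_; -_; _^_)
open import Data.Integer.Properties
  using (*-1-commutativeMonoid; *-comm; *-identityʳ; neg-involutive; -1*i≡-i)
open import Data.Fin as F using (Fin; inject₁; fromℕ; toℕ)
open import Data.Fin.Properties using (toℕ-injective; toℕ-fromℕ<; toℕ-inject₁; toℕ-fromℕ; toℕ<n)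
open import Data.Vec.Functional using (replicate)
open import Data.Product using (_,_)
open import Data.Sum using (inj₁; inj₂)
open import Function using (_∘_)
open import Relation.Binary.PropositionalEquality using (refl; sym; trans; cong; cong₂; subst)
open Relation.Binary.PropositionalEquality.≡-Reasoning

-- Sums over the multiplicative monoid of ℤ are products; its "zero" is 1ℤ.
open import Algebra.Properties.CommutativeMonoid.Sum *-1-commutativeMonoid
  using (sum-cong-≗; sum-init-last; ∑-distrib-+; sum-replicate-zero)
  renaming (sum to ∏)

prod≡∏ : ∀ {k} (g : Fin k → ℤ) → prod g ≡ ∏ g
prod≡∏ {zero}  g = refl
prod≡∏ {suc k} g = cong (g F.zero *_) (prod≡∏ (g ∘ F.suc))

∏-replicate : ∀ k c → ∏ (replicate k c) ≡ c ^ k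
∏-replicate zero    c = refl
∏-replicate (suc k) c = cong (c *_) (∏-replicate k c)

next-inject₁ : ∀ {m} (t : Fin m) → next (inject₁ t) ≡ F.suc t
next-inject₁ {m} t = toℕ-injective (begin
  toℕ (next (inject₁ t))          ≡⟨ toℕ-fromℕ< _ ⟩
  suc (toℕ (inject₁ t)) ℕ.% suc m ≡⟨ cong (λ k → suc k ℕ.% suc m) (toℕ-inject₁ t) ⟩
  suc (toℕ t) ℕ.% suc m           ≡⟨ m<n⇒m%n≡m (ℕ.s≤s (toℕ<n t)) ⟩
  suc (toℕ t)                     ∎)

next-fromℕ : ∀ m → next (fromℕ m) ≡ F.zero
next-fromℕ m = toℕ-injective (begin
  toℕ (next (fromℕ m))          ≡⟨ toℕ-fromℕ< _ ⟩
  suc (toℕ (fromℕ m)) ℕ.% suc m ≡⟨ cong (λ k → suc k ℕ.% suc m) (toℕ-fromℕ m) ⟩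
  suc m ℕ.% suc m               ≡⟨ n%n≡0 (suc m) ⟩
  0                             ∎)

∏-next : ∀ {m} (g : Fin (suc m) → ℤ) → ∏ (g ∘ next) ≡ ∏ g
∏-next {m} g = begin
  ∏ (g ∘ next)                                ≡⟨ sum-init-last (g ∘ next) ⟩
  ∏ (g ∘ next ∘ inject₁) * g (next (fromℕ m)) ≡⟨ cong₂ _*_ (sum-cong-≗ (cong g ∘ next-inject₁))
                                                            (cong g (next-fromℕ m)) ⟩
  ∏ (g ∘ F.suc) * g F.zero                    ≡⟨ *-comm (∏ (g ∘ F.suc)) (g F.zero) ⟩
  ∏ g                                         ∎

∏-cyclic-products-of-units : ∀ {m} (u : Fin (suc m) → ℤ) → (∀ t → u t * u t ≡ 1ℤ) →
  ∏ (λ t → u t * u (next t)) ≡ 1ℤ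
∏-cyclic-products-of-units {m} u unit = begin
  ∏ (λ t → u t * u (next t))  ≡⟨ ∑-distrib-+ u (u ∘ next) ⟩
  ∏ u * ∏ (u ∘ next)          ≡⟨ cong (∏ u *_) (∏-next u) ⟩
  ∏ u * ∏ u                   ≡⟨ sym (∑-distrib-+ u u) ⟩
  ∏ (λ t → u t * u t)         ≡⟨ sum-cong-≗ unit ⟩
  ∏ (replicate (suc m) 1ℤ)    ≡⟨ sum-replicate-zero (suc m) ⟩
  1ℤ                          ∎

-1^-suc-suc : ∀ k → -1ℤ ^ suc (suc k) ≡ -1ℤ ^ k
-1^-suc-suc k = begin
  -1ℤ * (-1ℤ * -1ℤ ^ k) ≡⟨ -1*i≡-i _ ⟩
  - (-1ℤ * -1ℤ ^ k)     ≡⟨ cong -_ (-1*i≡-i _) ⟩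
  - - -1ℤ ^ k           ≡⟨ neg-involutive _ ⟩
  -1ℤ ^ k               ∎

-1^-parity : ∀ k → (-1ℤ ^ k ≡ 1ℤ × 2 ∣ k) ⊎ (-1ℤ ^ k ≡ -1ℤ × ¬ (2 ∣ k))
-1^-parity zero          = inj₁ (refl , 2 ∣0)
-1^-parity (suc zero)    = inj₂ (refl , λ 2∣1 → 2≢1 (∣1⇒≡1 2∣1))
  where
  2≢1 : ¬ (2 ≡ 1)
  2≢1 ()
-1^-parity (suc (suc k)) with -1^-parity k
... | inj₁ (eq , 2∣k) = inj₁ (trans (-1^-suc-suc k) eq , ∣m∣n⇒∣m+n (∣-refl {2}) 2∣k)
... | inj₂ (eq , 2∤k) = inj₂ (trans (-1^-suc-suc k) eq , λ 2∣2+k → 2∤k (∣m+n∣m⇒∣n 2∣2+k (∣-refl {2})))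

s-square : ∀ b → s b * s b ≡ 1ℤ
s-square true  = refl
s-square false = refl

sign-frustrated : ∀ {n} {f : BAN n} (x : Config n) (a : Arc f) → Frustrated x a →
  sign a ≡ -1ℤ * (s (x (src a)) * s (x (tgt a)))
sign-frustrated x a frustrated = begin
  sign a                                ≡⟨ neg-involutive (sign a) ⟨
  - - sign a                            ≡⟨ cong -_ frustrated ⟨
  - (s (x (src a)) * s (x (tgt a)))     ≡⟨ -1*i≡-i _ ⟨
  -1ℤ * (s (x (src a)) * s (x (tgt a))) ∎

cycleSign-frustrated : ∀ {n} {f : BAN n} {m} (x : Config n) (C : Cycle f m) →
  (∀ t → Frustrated x (arcs C t)) → cycleSign C ≡ -1ℤ ^ suc m
cycleSign-frustrated {m = m} x C frustrated = begin
  prod (sign ∘ arcs C)                                     ≡⟨ prod≡∏ (sign ∘ arcs C) ⟩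
  ∏ (sign ∘ arcs C)                                        ≡⟨ sum-cong-≗ sign-arc ⟩
  ∏ (λ t → -1ℤ * (u t * u (next t)))                       ≡⟨ ∑-distrib-+ (replicate (suc m) -1ℤ)
                                                                          (λ t → u t * u (next t)) ⟩
  ∏ (replicate (suc m) -1ℤ) * ∏ (λ t → u t * u (next t))   ≡⟨ cong₂ _*_ (∏-replicate (suc m) -1ℤ)
                                                              (∏-cyclic-products-of-units u (s-square ∘ x ∘ src ∘ arcs C)) ⟩
  -1ℤ ^ suc m * 1ℤ                                         ≡⟨ *-identityʳ (-1ℤ ^ suc m) ⟩
  -1ℤ ^ suc m                                              ∎
  where
  u : Fin (suc m) → ℤ
  u t = s (x (src (arcs C t)))
  sign-arc : ∀ t → sign (arcs C t) ≡ -1ℤ * (u t * u (next t))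
  sign-arc t = trans (sign-frustrated x (arcs C t) (frustrated t))
                     (cong (λ i → -1ℤ * (u t * s (x i))) (closed C t))

proposition1 : ∀ (n : ℕ) (f : BAN n) → Monotone f →
    ∀ (m : ℕ) (C : Cycle f m) → Critical C →
    (cycleSign C ≡ 1ℤ × 2 ∣ length C) ⊎ (cycleSign C ≡ -1ℤ × ¬ (2 ∣ length C))
proposition1 n f _ m C (x , _ , frustrated) =
  subst (λ c → (c ≡ 1ℤ × 2 ∣ suc m) ⊎ (c ≡ -1ℤ × ¬ (2 ∣ suc m)))
        (sym (cycleSign-frustrated x C frustrated))
        (-1^-parity (suc m))
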